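{- Consider two-color Babylon played with $2m$ chips in total. Let $S$ be an even state in which there is exactly one stack $X$ of some color $x$ and at least one stack of the other color $y$. If the height of $X$ exceeds $m$, then $S$ is safe.
   Context: Two-color Babylon: the game starts with $2m$ chips, each red or blue, each chip forming its own stack of height $1$. Players Alice (who moves first) and Bob alternate moves; a move consists of choosing two distinct stacks that have the same height or the same top color (or both) and placing one of them on top of the other. The color of a stack is the color of its top chip; the height of a stack is its number of chips. The last player to make a legal move wins. A state is a configuration of stacks (each with a height and a color) reachable in such a game; it is even or odd according to the parity of its number of stacks (Alice moves from even states, Bob from odd states). Safe states are defined recursively: an even state with no legal move is safe; an even state with a legal move is safe if every move from it produces a safe state; an odd state is safe if some move from it produces a safe state. (Equivalently, a safe state is one from which Bob wins with best play.) -}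

module Defs where

open import Data.Nat using (ℕ; _+_; _*_; _%_)
open import Data.Product using (Σ; _×_; _,_; proj₁; proj₂)
open import Data.Sum using (_⊎_)
open import Data.List using (List; []; _∷_; length; map)
open import Data.List.Relation.Binary.Permutation.Propositional using (_↭_)
open import Relation.Binary.PropositionalEquality using (_≡_)

data Color : Set where
  red blue : Color

other : Color → Color
other red  = blue
other blue = red

-- a stack: (height , colour of its top chip)
Stack : Set
Stack = ℕ × Color

height : Stack → ℕ
height = proj₁

color : Stack → Color
color = proj₂

-- a state is a finite multiset of stacks, represented as a list
-- (order irrelevant: moves are defined up to permutation)
State : Set
State = List Stack

Compatible : Stack → Stack → Set
Compatible a b = (height a ≡ height b) ⊎ (color a ≡ color b)

-- Placing b on a is the
-- same move with the roles exchanged via the permutation.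
data Move : State → State → Set where
  move : ∀ {S} (a b : Stack) (rest : List Stack) →
         S ↭ (a ∷ b ∷ rest) → Compatible a b →
         Move S ((height a + height b , color a) ∷ rest)

EvenState : State → Set
EvenState S = length S % 2 ≡ 0

OddState : State → Set
OddState S = length S % 2 ≡ 1

Initial : ℕ → State → Set
Initial m S = Σ (List Color) (λ cs → (length cs ≡ 2 * m) × (S ≡ map (λ c → (1 , c)) cs))

data Reachable (m : ℕ) : State → Set where
  start : ∀ {S} → Initial m S → Reachable m S
  step  : ∀ {S S'} → Reachable m S → Move S S' → Reachable m S'

-- safe states (recursive definition; well-founded since every move
-- decreases the number of stacks):
--  * an even state is safe if every move from it leads to a safe state
--    (vacuously true when no legal move exists);
--  * an odd state is safe if some move from it leads to a safe state.
data Safe : State → Set where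
  safe-even : ∀ {S} → EvenState S → (∀ S' → Move S S' → Safe S') → Safe S
  safe-odd  : ∀ {S} S' → OddState S → Move S S' → Safe S' → Safe S

-- The stack X is taller than all other stacks together and is the only
-- stack of its colour, so it can neither be moved nor be covered: every
-- move merges two of the other stacks, which all have the other colour.
-- Whatever two stacks Alice merges, Bob merges the result with a third
-- one; this keeps X dominant and keeps the number of other stacks odd.
-- Each round removes two stacks, so Alice is eventually left with a
-- single other stack and no legal move.
module Submission where

open import Defs
open import Data.Nat using (ℕ; suc; _+_; _*_; _%_; _≤_; _<_; _>_)
open import Data.Nat.Properties
  using (+-assoc; +-identityʳ; m≤m+n; m≤n+m; ≤-trans; <-trans; <-irrefl; ≤-<-trans; +-cancelˡ-<; +-monoˡ-<; suc-injective)
open import Data.Nat.DivMod using ([m+kn]%n≡m%n)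
open import Data.Nat.ListAction using (sum)
open import Data.Nat.ListAction.Properties using (sum-↭)
open import Data.Product using (∃-syntax; _×_; _,_)
open import Data.Sum using (inj₁; inj₂)
open import Data.List using (List; []; _∷_; _++_; length; map)
open import Data.List.Membership.Propositional using (_∈_)
open import Data.List.Membership.Propositional.Properties using (∈-∃++)
open import Data.List.Relation.Binary.Permutation.Propositional
  using (_↭_; ↭-refl; ↭-prep; ↭-swap; ↭-sym; ↭-trans)
open import Data.List.Relation.Binary.Permutation.Propositional.Properties
  using (map⁺; ∈-resp-↭; All-resp-↭; ↭-length; drop-∷; shift)
open import Data.List.Relation.Unary.All using (All; _∷_) renaming (lookup to lookupAll)
open import Data.List.Relation.Unary.Any using (Any; here; there)
open import Data.Empty using (⊥-elim)
open import Relation.Nullary using (¬_)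
open import Relation.Binary.PropositionalEquality
  using (_≡_; _≢_; refl; sym; trans; cong; subst)

≢⇒≡other : ∀ {c x : Color} → c ≢ x → c ≡ other x
≢⇒≡other {red}  {red}  c≢x = ⊥-elim (c≢x refl)
≢⇒≡other {red}  {blue} _   = refl
≢⇒≡other {blue} {red}  _   = refl
≢⇒≡other {blue} {blue} c≢x = ⊥-elim (c≢x refl)

≢-same-colour : ∀ {c d x : Color} → c ≢ x → d ≢ x → c ≡ d
≢-same-colour c≢x d≢x = trans (≢⇒≡other c≢x) (sym (≢⇒≡other d≢x))

Compatible-sym : ∀ {a b} → Compatible a b → Compatible b a
Compatible-sym (inj₁ eq) = inj₁ (sym eq)
Compatible-sym (inj₂ eq) = inj₂ (sym eq)

merge : Stack → Stack → Stack
merge a b = (height a + height b , color a)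

totalHeight : List Stack → ℕ
totalHeight S = sum (map height S)

totalHeight-↭ : ∀ {S T} → S ↭ T → totalHeight S ≡ totalHeight T
totalHeight-↭ p = sum-↭ (map⁺ height p)

totalHeight-merge : ∀ a b r → totalHeight (merge a b ∷ r) ≡ totalHeight (a ∷ b ∷ r)
totalHeight-merge a b r = +-assoc (height a) (height b) (totalHeight r)

totalHeight-move : ∀ {S T} → Move S T → totalHeight T ≡ totalHeight S
totalHeight-move (move a b r p _) = trans (totalHeight-merge a b r) (sym (totalHeight-↭ p))

totalHeight-singletons : ∀ cs → totalHeight (map (λ c → (1 , c)) cs) ≡ length cs
totalHeight-singletons []       = refl
totalHeight-singletons (c ∷ cs) = cong suc (totalHeight-singletons cs)

totalHeight-reachable : ∀ {m S} → Reachable m S → totalHeight S ≡ 2 * m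
totalHeight-reachable (start (cs , len , refl)) = trans (totalHeight-singletons cs) len
totalHeight-reachable (step R mv) = trans (totalHeight-move mv) (totalHeight-reachable R)

height≤totalHeight : ∀ {s S} → s ∈ S → height s ≤ totalHeight S
height≤totalHeight {S = s ∷ S} (here refl) = m≤m+n (height s) (totalHeight S)
height≤totalHeight {S = t ∷ S} (there s∈S) =
  ≤-trans (height≤totalHeight s∈S) (m≤n+m (totalHeight S) (height t))

∈⇒↭∷ : ∀ {A : Set} {x : A} {xs} → x ∈ xs → ∃[ ys ] xs ↭ x ∷ ys
∈⇒↭∷ x∈xs with ys , zs , refl ← ∈-∃++ x∈xs = ys ++ zs , shift _ ys zs

length%2-↭ : ∀ r k {S T : List Stack} → S ↭ T → length T ≡ r + k * 2 →
             length S % 2 ≡ r % 2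
length%2-↭ r k p len = trans (cong (_% 2) (trans (↭-length p) len)) ([m+kn]%n≡m%n r k 2)

suc%2≡0⇒odd : ∀ n → suc n % 2 ≡ 0 → ∃[ k ] n ≡ suc (k * 2)
suc%2≡0⇒odd 0             ()
suc%2≡0⇒odd 1             _    = 0 , refl
suc%2≡0⇒odd (suc (suc n)) even with k , eq ← suc%2≡0⇒odd n even =
  suc k , cong (λ j → suc (suc j)) eq

smaller-summand : ∀ {m a b} → m < a → a + b ≡ 2 * m → b < a
smaller-summand {m} {a} {b} m<a a+b≡2m = <-trans b<m m<a
  where
  m+b<m+m : m + b < m + m
  m+b<m+m = subst (m + b <_) (trans a+b≡2m (cong (m +_) (+-identityʳ m))) (+-monoˡ-< b m<a)
  b<m : b < m
  b<m = +-cancelˡ-< m b m m+b<m+m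

record Dominates (X : Stack) (rest : List Stack) : Set where
  field
    colours-differ : All (λ s → color s ≢ color X) rest
    taller         : totalHeight rest < height X
open Dominates

Dominates-↭ : ∀ {X rest rest'} → rest ↭ rest' → Dominates X rest → Dominates X rest'
Dominates-↭ p dom = record
  { colours-differ = All-resp-↭ p (colours-differ dom)
  ; taller         = subst (_< _) (totalHeight-↭ p) (taller dom)
  }

Dominates-merge : ∀ {X a b r} → Dominates X (a ∷ b ∷ r) → Dominates X (merge a b ∷ r)
Dominates-merge {X} {a} {b} {r} dom with a≢X ∷ _ ∷ r≢X ← colours-differ dom = record
  { colours-differ = a≢X ∷ r≢X
  ; taller         = subst (_< height X) (sym (totalHeight-merge a b r)) (taller dom)
  }

dominated-incompatible : ∀ {X rest s} → Dominates X rest → s ∈ rest → ¬ Compatible X s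
dominated-incompatible dom s∈rest (inj₁ X≡s) =
  <-irrefl (sym X≡s) (≤-<-trans (height≤totalHeight s∈rest) (taller dom))
dominated-incompatible dom s∈rest (inj₂ X≡s) = lookupAll (colours-differ dom) s∈rest (sym X≡s)

move-avoids-dominant : ∀ {X rest a b r} → Dominates X rest → X ∷ rest ↭ a ∷ b ∷ r →
                       Compatible a b → ∃[ r' ] (rest ↭ a ∷ b ∷ r' × r ↭ X ∷ r')
move-avoids-dominant {X} {rest} {a} {b} {r} dom p ab with ∈-resp-↭ p (here refl)
... | here refl =
  ⊥-elim (dominated-incompatible dom (∈-resp-↭ (↭-sym (drop-∷ p)) (here refl)) ab)
... | there (here refl) =
  ⊥-elim (dominated-incompatible dom (∈-resp-↭ (↭-sym rest↭) (here refl)) (Compatible-sym ab))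
  where
  rest↭ : rest ↭ a ∷ r
  rest↭ = drop-∷ (↭-trans p (↭-swap a X ↭-refl))
... | there (there X∈r) with r' , r↭ ← ∈⇒↭∷ X∈r =
  r' , drop-∷ (↭-trans p (↭-trans (↭-prep a (↭-prep b r↭)) (shift X (a ∷ b ∷ []) r'))) , r↭

dominant-safe : ∀ k {S X rest} → S ↭ X ∷ rest → length rest ≡ suc (k * 2) →
                Dominates X rest → Safe S
dominant-odd-safe : ∀ k {T X c rest} → T ↭ X ∷ c ∷ rest → suc (length rest) ≡ k * 2 →
                    Dominates X (c ∷ rest) → Safe T

dominant-safe k {S} {X} {rest} p len dom = safe-even (length%2-↭ 0 (suc k) p (cong suc len)) alice
  where
  alice : ∀ T → Move S T → Safe T
  alice _ (move a b r q ab) with r' , rest↭ , r↭ ← move-avoids-dominant dom (↭-trans (↭-sym p) q) ab =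
    dominant-odd-safe k (↭-trans (↭-prep (merge a b) r↭) (↭-swap _ _ ↭-refl))
      (suc-injective (trans (sym (↭-length rest↭)) len))
      (Dominates-merge (Dominates-↭ rest↭ dom))

dominant-odd-safe (suc k) {X = X} {c} {d ∷ r} p len dom =
  safe-odd _ (length%2-↭ 1 (suc k) p (cong suc len))
    (move c d (X ∷ r) (↭-trans p (↭-sym (shift X (c ∷ d ∷ []) r))) (inj₂ c≡d))
    (dominant-safe k (↭-swap _ _ ↭-refl) (cong suc (suc-injective (suc-injective len)))
      (Dominates-merge dom))
  where
  c≡d : color c ≡ color d
  c≡d with c≢X ∷ d≢X ∷ _ ← colours-differ dom = ≢-same-colour c≢X d≢X

lemma1 : (m : ℕ) (S : State) → Reachable m S → EvenState S →
    (x : Color) (X : Stack) (rest : List Stack) →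
    S ↭ (X ∷ rest) → color X ≡ x →
    All (λ s → color s ≢ x) rest →
    Any (λ s → color s ≡ other x) rest →
    height X > m → Safe S
lemma1 m S R even x X rest p refl colours _ X>m
  with k , len ← suc%2≡0⇒odd (length rest) (trans (cong (_% 2) (sym (↭-length p))) even) =
  dominant-safe k p len record
    { colours-differ = colours
    ; taller         = smaller-summand X>m (trans (sym (totalHeight-↭ p)) (totalHeight-reachable R))
    }
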